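{- Let $G$ and $H$ be finite simple graphs on a common vertex set $V$ with $\deg_G(v)=\deg_H(v)$ for all $v\in V$, with adjacency matrices $A$ and $B$. Let $V=\bigsqcup_{i=1}^pV_i$ be the partition of $V$ by degree, $e_i\in\{0,1\}^V$ the characteristic vector of $V_i$, $J_{i,j}=e_ie_j^\top$, and $D_i$ the diagonal $0/1$ matrix with $D_i(v,v)=1$ iff $v\in V_i$. With indeterminates $s_0,s_1,\dots,s_p$ and $s_{i,j}$ ($1\le i,j\le p$), define - $A'=s_0A+s_1D_1+\cdots+s_pD_p$ and $B'=s_0B+s_1D_1+\cdots+s_pD_p$; - $A''=s_0A+s_1J_{1,1}+\cdots+s_pJ_{p,p}$ and $B''=s_0B+s_1J_{1,1}+\cdots+s_pJ_{p,p}$; - $A'''=s_0A+\sum_{i,j=1}^ps_{i,j}J_{i,j}$ and $B'''=s_0B+\sum_{i,j=1}^ps_{i,j}J_{i,j}$. Then the following are equivalent: (1) $I_{A,2}(t)=I_{B,2}(t)$; (2) $I_{A',2}(t)=I_{B',2}(t)$; (3) $I_{A'',2}(t)=I_{B'',2}(t)$; (4) $I_{A''',2}(t)=I_{B''',2}(t)$.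
   Context: The matrices $A',\dots,B'''$ have entries in the polynomial ring over the indeterminates. WL invariants of a matrix $M:V\times V\to C$: the atomic type $\mathrm{tp}_M(i_1,\dots,i_k)$ is the $k\times k$ array $T$ with $T_{a,b}=(0,M(i_a,i_b))$ if $i_a=i_b$ and $(1,M(i_a,i_b))$ otherwise; $X^1_{M,2}=\mathrm{tp}_M$ on pairs and $X^{r+1}_{M,2}(i,j)=\big(X^r_{M,2}(i,j),\{\!\{(\mathrm{tp}_M(i,j,m),X^r_{M,2}(i,m),X^r_{M,2}(m,j)):m\in V\}\!\}\big)$ ($\{\!\{\cdot\}\!\}$ a multiset; colors are abstract objects built this way, comparable across matrices). $M^r_{M,2}=\{\!\{X^r_{M,2}(x):x\in V^2\}\!\}$ and $I_{M,2}(t)=\sum_{r\ge1}t^rM^r_{M,2}$ as a formal series. -}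

module Defs where

open import Data.Nat using (ℕ; zero; suc)
open import Data.Bool using (Bool; true; false; _∧_; if_then_else_)
open import Data.Fin using (Fin; _≟_)
open import Data.Fin.Properties using () renaming (_≟_ to _≟F_)
open import Data.Vec using (Vec; []; _∷_; tabulate; replicate) renaming (map to vmap)
open import Data.Nat.ListAction using (sum)
open import Data.List using (allFin) renaming (map to lmap)
open import Data.Product using (_×_; _,_; Σ; ∃)
open import Relation.Nullary.Decidable using (⌊_⌋)
open import Relation.Binary.PropositionalEquality using (_≡_)
open import Function.Bundles using (_↔_; Inverse; _⇔_)

ind : Bool → ℕ
ind true  = 1
ind false = 0

Mat : ℕ → Set → Set
Mat n C = Fin n → Fin n → C

atom : ∀ {n} {C : Set} → Mat n C → Fin n → Fin n → ℕ × C
atom M a b = (if ⌊ a ≟ b ⌋ then 0 else 1) , M a b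

tp : ∀ {n k} {C : Set} → Mat n C → Vec (Fin n) k → Vec (Vec (ℕ × C) k) k
tp M is = vmap (λ a → vmap (λ b → atom M a b) is) is

-- SameColor r M N x y  :  X^{r+1}_{M,2}(x) = X^{r+1}_{N,2}(y)   (colors as abstract
-- objects, compared across the two matrices).  Equality of the multisets
-- {{ f(m) : m ∈ V }} and {{ g(m) : m ∈ V }} is the existence of a bijection π of V
-- with f(m) = g(π m) for all m.
SameColor : ∀ {n} {C : Set} → ℕ → Mat n C → Mat n C →
            Fin n × Fin n → Fin n × Fin n → Set
SameColor zero M N (i , j) (i' , j') = tp M (i ∷ j ∷ []) ≡ tp N (i' ∷ j' ∷ [])
SameColor {n} (suc r) M N (i , j) (i' , j') =
  SameColor r M N (i , j) (i' , j') ×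
  Σ (Fin n ↔ Fin n) λ π → ∀ m →
    let m' = Inverse.to π m in
    tp M (i ∷ j ∷ m ∷ []) ≡ tp N (i' ∷ j' ∷ m' ∷ []) ×
    SameColor r M N (i , m) (i' , m') ×
    SameColor r M N (m , j) (m' , j')

SameMultiset : ∀ {n} {C : Set} → ℕ → Mat n C → Mat n C → Set
SameMultiset {n} r M N =
  Σ ((Fin n × Fin n) ↔ (Fin n × Fin n)) λ σ →
    ∀ x → SameColor r M N x (Inverse.to σ x)

-- I_{M,2}(t) = I_{N,2}(t) as formal series: all coefficients M^r (r ≥ 1) agree
SameI : ∀ {n} {C : Set} → Mat n C → Mat n C → Set
SameI M N = ∀ r → SameMultiset r M N

record IsSimple {n : ℕ} (G : Mat n Bool) : Set where
  field
    symm  : ∀ u v → G u v ≡ G v u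
    irrfl : ∀ v → G v v ≡ false

adj : ∀ {n} → Mat n Bool → Mat n ℕ
adj G u v = ind (G u v)

deg : ∀ {n} → Mat n Bool → Fin n → ℕ
deg {n} G v = sum (lmap (λ u → ind (G v u)) (allFin n))

record IsDegreePartition {n p : ℕ} (G : Mat n Bool) (cls : Fin n → Fin p) : Set where
  field
    onto  : ∀ i → ∃ λ v → cls v ≡ i
    exact : ∀ u v → (cls u ≡ cls v) ⇔ (deg G u ≡ deg G v)

-- Linear polynomials in the indeterminates s_0, s_1..s_p, s_{i,j} (1 ≤ i,j ≤ p),
-- with zero constant term, represented by their coefficient vectors.

record Poly (p : ℕ) : Set where
  constructor poly
  field
    c0 : ℕ                    -- coefficient of s_0
    c1 : Vec ℕ p              -- coefficients of s_1 … s_p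
    c2 : Vec (Vec ℕ p) p      -- coefficients of s_{i,j}

zeros2 : ∀ {p} → Vec (Vec ℕ p) p
zeros2 {p} = replicate p (replicate p 0)

mat′ : ∀ {n p} → (Fin n → Fin p) → Mat n Bool → Mat n (Poly p)
mat′ cls G u v =
  poly (ind (G u v)) (tabulate λ i → ind (⌊ u ≟ v ⌋ ∧ ⌊ cls u ≟ i ⌋)) zeros2

mat″ : ∀ {n p} → (Fin n → Fin p) → Mat n Bool → Mat n (Poly p)
mat″ cls G u v =
  poly (ind (G u v)) (tabulate λ i → ind (⌊ cls u ≟ i ⌋ ∧ ⌊ cls v ≟ i ⌋)) zeros2

mat‴ : ∀ {n p} → (Fin n → Fin p) → Mat n Bool → Mat n (Poly p)
mat‴ {p = p} cls G u v =
  poly (ind (G u v)) (replicate p 0)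
       (tabulate λ i → tabulate λ j → ind (⌊ cls u ≟ i ⌋ ∧ ⌊ cls v ≟ j ⌋))

-- A single round of colour refinement already sees the degree of both endpoints of a
-- pair: the multiset of triple types at (i, j) contains the row of i and the column
-- of j, whose sums are the degrees. Since the parts V_i are exactly the degree
-- classes, X^{r+1} over A determines X^r over any matrix built entrywise from the
-- adjacency entry, the equality flag and the parts of the two endpoints — such as A',
-- A'' and A'''. Conversely the s_0-coefficient of each of these is A, and colours
-- survive any entrywise map.
module Submission where

open import Defs
open import Data.Nat using (ℕ; zero; suc; _+_)
open import Data.Bool using (Bool; true; false; _∧_; if_then_else_)
open import Data.Fin using (Fin; zero; suc; _≟_)
open import Data.Product using (_×_; _,_; proj₁; proj₂; map₂)
open import Data.Vec using (Vec; []; _∷_; lookup; tabulate; replicate) renaming (map to vmap)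
open import Data.Vec.Properties using (lookup-map)
open import Data.List using (allFin) renaming (map to lmap; tabulate to ltabulate)
open import Data.List.Properties using (map-tabulate; map-cong)
open import Data.Nat.ListAction using (sum)
open import Data.Nat.Properties using (+-0-commutativeMonoid)
open import Relation.Nullary.Decidable using (⌊_⌋)
open import Relation.Binary.PropositionalEquality
  using (_≡_; refl; sym; trans; cong; cong₂; module ≡-Reasoning)
open import Function using (id)
open import Function.Bundles using (_⇔_; _↔_; Inverse; Equivalence; mk⇔)
import Algebra.Properties.CommutativeMonoid.Sum +-0-commutativeMonoid as Σ

private
  variable
    n k : ℕ
    C D K : Set

sum-tabulate : (f : Fin n → ℕ) → sum (ltabulate f) ≡ Σ.sum f
sum-tabulate {zero}  f = refl
sum-tabulate {suc n} f = cong (f zero +_) (sum-tabulate (λ x → f (suc x)))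

sum-allFin : (f : Fin n → ℕ) → sum (lmap f (allFin n)) ≡ Σ.sum f
sum-allFin f = trans (cong sum (map-tabulate id f)) (sum-tabulate f)

sum-allFin-permute : (f g : Fin n → ℕ) (π : Fin n ↔ Fin n) →
  (∀ m → f m ≡ g (Inverse.to π m)) →
  sum (lmap f (allFin n)) ≡ sum (lmap g (allFin n))
sum-allFin-permute f g π f≗g∘π = begin
  sum (lmap f (allFin _))           ≡⟨ sum-allFin f ⟩
  Σ.sum f                           ≡⟨ Σ.sum-cong-≗ f≗g∘π ⟩
  Σ.sum (λ m → g (Inverse.to π m))  ≡⟨ Σ.sum-permute g π ⟨
  Σ.sum g                           ≡⟨ sum-allFin g ⟨
  sum (lmap g (allFin _))           ∎
  where open ≡-Reasoning

map-≡ : {X Y Z : Set} {f : X → Z} {g : Y → Z} (xs : Vec X k) (ys : Vec Y k) →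
  (∀ q → f (lookup xs q) ≡ g (lookup ys q)) → vmap f xs ≡ vmap g ys
map-≡ []       []       h = refl
map-≡ (x ∷ xs) (y ∷ ys) h = cong₂ _∷_ (h zero) (map-≡ xs ys (λ q → h (suc q)))

rowSum colSum : Mat n ℕ → Fin n → ℕ
rowSum {n} M i = sum (lmap (M i) (allFin n))
colSum {n} M j = sum (lmap (λ m → M m j) (allFin n))

SameColor-map : (f : C → D) {M N : Mat n C} → ∀ r {x y} → SameColor r M N x y →
  SameColor r (λ a b → f (M a b)) (λ a b → f (N a b)) x y
SameColor-map f zero    same = cong (vmap (vmap (map₂ f))) same
SameColor-map f (suc r) (same , π , h) =
  SameColor-map f r same , π , λ m →
    cong (vmap (vmap (map₂ f))) (proj₁ (h m)) ,
    SameColor-map f r (proj₁ (proj₂ (h m))) ,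
    SameColor-map f r (proj₂ (proj₂ (h m)))

SameI-map : (f : C → D) {M N : Mat n C} → SameI M N →
  SameI (λ a b → f (M a b)) (λ a b → f (N a b))
SameI-map f same r = proj₁ (same r) , λ x → SameColor-map f r (proj₂ (same r) x)

lookup-tp : (M : Mat n C) (is : Vec (Fin n) k) (q l : Fin k) →
  lookup (lookup (tp M is) q) l ≡ atom M (lookup is q) (lookup is l)
lookup-tp M is q l = trans (cong (λ v → lookup v l) (lookup-map q _ is)) (lookup-map l _ is)

tp-≡⇒atom-≡ : {M N : Mat n C} (is is' : Vec (Fin n) k) → tp M is ≡ tp N is' →
  ∀ q l → atom M (lookup is q) (lookup is l) ≡ atom N (lookup is' q) (lookup is' l)
tp-≡⇒atom-≡ {M = M} {N} is is' eq q l =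
  trans (sym (lookup-tp M is q l))
    (trans (cong (λ T → lookup (lookup T q) l) eq) (lookup-tp N is' q l))

atom-≡⇒tp-≡ : {M N : Mat n C} (is is' : Vec (Fin n) k) →
  (∀ q l → atom M (lookup is q) (lookup is l) ≡ atom N (lookup is' q) (lookup is' l)) →
  tp M is ≡ tp N is'
atom-≡⇒tp-≡ is is' h = map-≡ is is' λ q → map-≡ is is' (h q)

distinctness-injective : ∀ x y → (if x then 0 else 1) ≡ (if y then 0 else 1) → x ≡ y
distinctness-injective true  true  _ = refl
distinctness-injective false false _ = refl

refine : (Bool → C → K → K → D) → (Fin n → K) → Mat n C → Mat n D
refine Φ κ M u v = Φ ⌊ u ≟ v ⌋ (M u v) (κ u) (κ v)

atom-refine : (Φ : Bool → C → K → K → D) (κ : Fin n → K) {M N : Mat n C} {a b a' b' : Fin n} →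
  atom M a b ≡ atom N a' b' → κ a ≡ κ a' → κ b ≡ κ b' →
  atom (refine Φ κ M) a b ≡ atom (refine Φ κ N) a' b'
atom-refine Φ κ {a = a} {b} {a'} {b'} same κa κb =
  cong₂ _,_ (cong proj₁ same)
    (Φ-cong (distinctness-injective ⌊ a ≟ b ⌋ ⌊ a' ≟ b' ⌋ (cong proj₁ same))
            (cong proj₂ same) κa κb)
  where
  Φ-cong : ∀ {e e' c c' k k' l l'} → e ≡ e' → c ≡ c' → k ≡ k' → l ≡ l' → Φ e c k l ≡ Φ e' c' k' l'
  Φ-cong refl refl refl refl = refl

tp-refine : (Φ : Bool → C → K → K → D) (κ : Fin n → K) {M N : Mat n C}
  (is is' : Vec (Fin n) k) → tp M is ≡ tp N is' →
  (∀ q → κ (lookup is q) ≡ κ (lookup is' q)) →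
  tp (refine Φ κ M) is ≡ tp (refine Φ κ N) is'
tp-refine Φ κ {M} {N} is is' same κ≡ = atom-≡⇒tp-≡ is is' λ q l →
  atom-refine Φ κ {M} {N} (tp-≡⇒atom-≡ {M = M} {N} is is' same q l) (κ≡ q) (κ≡ l)

-- SameColor (suc r) is X^{r+2}: κ is determined as soon as one refinement round has been made.
ColourInvariant : (Fin n → K) → Mat n C → Mat n C → Set
ColourInvariant κ M N = ∀ r i j i' j' → SameColor (suc r) M N (i , j) (i' , j') →
  κ i ≡ κ i' × κ j ≡ κ j'

SameColor-refine : (Φ : Bool → C → K → K → D) (κ : Fin n → K) {M N : Mat n C} →
  ColourInvariant κ M N → ∀ r {x y} → SameColor (suc r) M N x y →
  SameColor r (refine Φ κ M) (refine Φ κ N) x y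
SameColor-refine Φ κ inv zero {i , j} {i' , j'} same@(tp≡ , _) =
  tp-refine Φ κ (i ∷ j ∷ []) (i' ∷ j' ∷ []) tp≡ λ where
    zero       → proj₁ (inv 0 i j i' j' same)
    (suc zero) → proj₂ (inv 0 i j i' j' same)
SameColor-refine Φ κ inv (suc r) {i , j} {i' , j'} (same , π , h) =
  SameColor-refine Φ κ inv r same , π , λ m →
    let (tp≡ , left , right) = h m
        m' = Inverse.to π m
    in tp-refine Φ κ (i ∷ j ∷ m ∷ []) (i' ∷ j' ∷ m' ∷ []) tp≡ (λ where
         zero             → proj₁ (inv r i j i' j' same)
         (suc zero)       → proj₂ (inv r i j i' j' same)
         (suc (suc zero)) → proj₂ (inv r i m i' m' left)) ,
       SameColor-refine Φ κ inv r left ,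
       SameColor-refine Φ κ inv r right

SameI-refine : (Φ : Bool → C → K → K → D) (κ : Fin n → K) {M N : Mat n C} →
  ColourInvariant κ M N → SameI M N → SameI (refine Φ κ M) (refine Φ κ N)
SameI-refine Φ κ inv same r =
  proj₁ (same (suc r)) , λ x → SameColor-refine Φ κ inv r (proj₂ (same (suc r)) x)

-- The entries M(i, m) and M(m, j) sit at positions (0, 2) and (2, 1) of tp(i, j, m).
SameColor-suc⇒rowSum-colSum : {M N : Mat n ℕ} → ∀ r {i j i' j'} →
  SameColor (suc r) M N (i , j) (i' , j') →
  rowSum M i ≡ rowSum N i' × colSum M j ≡ colSum N j'
SameColor-suc⇒rowSum-colSum {M = M} {N} r {i} {j} {i'} {j'} (_ , π , h) =
  sum-allFin-permute (M i) (N i') π (λ m → entry m zero (suc (suc zero))) ,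
  sum-allFin-permute (λ m → M m j) (λ m → N m j') π (λ m → entry m (suc (suc zero)) (suc zero))
  where
  entry : ∀ m q l →
    proj₂ (lookup (lookup (tp M (i ∷ j ∷ m ∷ [])) q) l) ≡
    proj₂ (lookup (lookup (tp N (i' ∷ j' ∷ Inverse.to π m ∷ [])) q) l)
  entry m q l = cong (λ T → proj₂ (lookup (lookup T q) l)) (proj₁ (h m))

colSum-adj : {G : Mat n Bool} → IsSimple G → ∀ v → colSum (adj G) v ≡ deg G v
colSum-adj {n} simple v =
  cong sum (map-cong (λ u → cong ind (IsSimple.symm simple u v)) (allFin n))

degreeClass-invariant : {G H : Mat n Bool} {p : ℕ} → IsSimple G → IsSimple H →
  (∀ v → deg G v ≡ deg H v) → (cls : Fin n → Fin p) → IsDegreePartition G cls →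
  ColourInvariant cls (adj G) (adj H)
degreeClass-invariant {G = G} {H} sG sH deg≡ cls partition r i j i' j' same =
  let rows , cols = SameColor-suc⇒rowSum-colSum r same
  in sameClass i i' rows ,
     sameClass j j' (trans (sym (colSum-adj sG j)) (trans cols (colSum-adj sH j')))
  where
  sameClass : ∀ u u' → deg G u ≡ deg H u' → cls u ≡ cls u'
  sameClass u u' e =
    Equivalence.from (IsDegreePartition.exact partition u u') (trans e (sym (deg≡ u')))

theorem3p5 : (n p : ℕ) (G H : Mat n Bool) → IsSimple G → IsSimple H →
    (∀ v → deg G v ≡ deg H v) →
    (cls : Fin n → Fin p) → IsDegreePartition G cls →
    (SameI (adj G) (adj H) ⇔ SameI (mat′ cls G) (mat′ cls H)) ×
    (SameI (adj G) (adj H) ⇔ SameI (mat″ cls G) (mat″ cls H)) ×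
    (SameI (adj G) (adj H) ⇔ SameI (mat‴ cls G) (mat‴ cls H))
theorem3p5 n p G H sG sH deg≡ cls partition =
  mk⇔ (refined Φ′) (SameI-map Poly.c0) ,
  mk⇔ (refined Φ″) (SameI-map Poly.c0) ,
  mk⇔ (refined Φ‴) (SameI-map Poly.c0)
  where
  refined : (Φ : Bool → ℕ → Fin p → Fin p → Poly p) →
    SameI (adj G) (adj H) → SameI (refine Φ cls (adj G)) (refine Φ cls (adj H))
  refined Φ = SameI-refine Φ cls (degreeClass-invariant sG sH deg≡ cls partition)

  Φ′ Φ″ Φ‴ : Bool → ℕ → Fin p → Fin p → Poly p
  Φ′ e a c d = poly a (tabulate λ i → ind (e ∧ ⌊ c ≟ i ⌋)) zeros2
  Φ″ e a c d = poly a (tabulate λ i → ind (⌊ c ≟ i ⌋ ∧ ⌊ d ≟ i ⌋)) zeros2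
  Φ‴ e a c d = poly a (replicate p 0) (tabulate λ i → tabulate λ j → ind (⌊ c ≟ i ⌋ ∧ ⌊ d ≟ j ⌋))
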